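{- Let $H$ and $K$ be finite transitive permutation groups on finite sets $\Delta$ and $\Lambda$ respectively, let $\delta_0\in\Delta$, $\lambda_0\in\Lambda$, and let $\ell$ be a positive integer. If $|\Delta|,|\Lambda|\ge 2$, then there exist a set $\Omega$ with $|\Omega|=\ell|\Delta||\Lambda|$, faithful actions (injective homomorphisms) $\rho_H:H\to\mathrm{Sym}(\Omega)$ and $\rho_K:K\to\mathrm{Sym}(\Omega)$, and a point $\omega\in\Omega$ such that: (1) $\rho_H(H)_\omega=\rho_H(H_{\delta_0})$ and $\rho_K(K)_\omega=\rho_K(K_{\lambda_0})$; (2) $\langle\rho_H(H),\rho_K(K)_\omega\rangle=\rho_H(H)\times\rho_K(K)_\omega$ and $\langle\rho_H(H)_\omega,\rho_K(K)\rangle=\rho_H(H)_\omega\times\rho_K(K)$ (internal direct products); (3) $\langle\rho_H(H),\rho_K(K)\rangle$ is transitive on $\Omega$.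
   Context: For a subgroup $X\le\mathrm{Sym}(\Omega)$ and $\omega\in\Omega$, $X_\omega$ denotes the stabiliser of $\omega$ in $X$; $H_{\delta_0}$ and $K_{\lambda_0}$ denote point stabilisers in the original actions. -}

module Defs where

open import Level using (Level; 0ℓ; suc)
open import Data.Nat using (ℕ)
open import Data.Fin using (Fin)
open import Data.Product using (Σ; ∃; _×_; _,_; proj₁)
open import Relation.Binary.PropositionalEquality using (_≡_)
open import Data.Fin.Permutation public
  using (Permutation′; _⟨$⟩ʳ_; _≈_; id; flip; _∘ₚ_)

-- Sym(Fin n) : permutations of Fin n; equality is pointwise (_≈_).
-- Composition: (π ∘ₚ σ) applies π first, then σ.

PermSet : ℕ → Set₁
PermSet n = Permutation′ n → Set

record IsSubgroup {n : ℕ} (P : PermSet n) : Set where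
  field
    resp  : ∀ {π σ} → π ≈ σ → P π → P σ
    hasId : P id
    comp  : ∀ {π σ} → P π → P σ → P (π ∘ₚ σ)
    inv   : ∀ {π} → P π → P (flip π)

IsTransitive : {n : ℕ} → PermSet n → Set
IsTransitive {n} P = ∀ (x y : Fin n) → ∃ λ π → P π × (π ⟨$⟩ʳ x ≡ y)

_≐_ : {n : ℕ} → PermSet n → PermSet n → Set
P ≐ Q = ∀ π → (P π → Q π) × (Q π → P π)

_∩_ : {n : ℕ} → PermSet n → PermSet n → PermSet n
(P ∩ Q) π = P π × Q π

Stab : {n : ℕ} → PermSet n → Fin n → PermSet n
Stab P ω π = P π × (π ⟨$⟩ʳ ω ≡ ω)

Elt : {n : ℕ} → PermSet n → Set
Elt {n} P = Σ (Permutation′ n) P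

record IsFaithfulAction {d m : ℕ} (H : PermSet d) (ρ : Elt H → Permutation′ m) : Set where
  field
    wellDef : ∀ (g h : Elt H) → proj₁ g ≈ proj₁ h → ρ g ≈ ρ h
    hom     : ∀ (g h : Elt H) (gh : Elt H) → proj₁ gh ≈ (proj₁ g ∘ₚ proj₁ h)
              → ρ gh ≈ (ρ g ∘ₚ ρ h)
    inj     : ∀ (g h : Elt H) → ρ g ≈ ρ h → proj₁ g ≈ proj₁ h

Image : {d m : ℕ} (H : PermSet d) (ρ : Elt H → Permutation′ m) → PermSet d → PermSet m
Image H ρ S π = ∃ λ (g : Elt H) → S (proj₁ g) × (π ≈ ρ g)

data Gen {n : ℕ} (A B : PermSet n) : PermSet n where
  inA  : ∀ {π} → A π → Gen A B π
  inB  : ∀ {π} → B π → Gen A B π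
  gid  : Gen A B id
  gcmp : ∀ {π σ} → Gen A B π → Gen A B σ → Gen A B (π ∘ₚ σ)
  ginv : ∀ {π} → Gen A B π → Gen A B (flip π)
  gresp : ∀ {π σ} → π ≈ σ → Gen A B π → Gen A B σ

IsNormalIn : {n : ℕ} → PermSet n → PermSet n → Set
IsNormalIn A G = ∀ {a g} → A a → G g → A (flip g ∘ₚ (a ∘ₚ g))

IsInternalDirectProduct : {n : ℕ} → PermSet n → PermSet n → Set
IsInternalDirectProduct A B =
    IsNormalIn A (Gen A B)
  × IsNormalIn B (Gen A B)
  × (∀ π → A π → B π → π ≈ id)
  × (∀ π → Gen A B π → ∃ λ a → ∃ λ b → A a × B b × (π ≈ (a ∘ₚ b)))

module Submission where

-- Put Ω = Fin ℓ × Δ × Λ (Δ = Fin d, Λ = Fin k), the point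
-- ω₀ = (0, δ₀, λ₀), and call the fibre over (δ₀, λ₀) the marked fibre.  K acts
-- on the Λ-coordinate.  H acts on the Δ-coordinate after conjugating by the
-- "twist" that rotates the marked fibre cyclically:
--   η · (i, δ, μ) = (r^{-[η δ, μ marked]} r^{[δ, μ marked]} i, η δ, μ).
-- Both actions are faithful, their stabilisers of ω₀ are H_{δ₀} and K_{λ₀}, and
-- η, κ commute whenever η fixes δ₀ or κ fixes λ₀, because then the twist is
-- invisible to the pair.  The two images meet trivially, which gives both
-- internal direct products.  Transitivity: H and K move every point into the
-- marked fibre, and the commutator [η, κ] with η δ₀ ≠ δ₀, κ λ₀ ≠ λ₀ rotates that
-- fibre by r, so ⟨ρ_H(H), ρ_K(K)⟩ reaches all of it.

open import Defs
open import Data.Nat using (ℕ; _*_; _≤_; _≥_; suc; zero; s≤s; z≤n)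
open import Data.Fin using (Fin; zero; suc; fromℕ; inject₁)
open import Data.Fin.Properties using (_≟_; *↔×; punchInᵢ≢i)
open import Data.Fin.Induction using (>-weakInduction)
open import Data.Fin.Permutation using (permutation; _⟨$⟩ˡ_; inverseˡ; inverseʳ)
open import Data.Bool using (Bool; true; false; _∧_)
open import Data.Bool.Properties using (∧-zeroʳ)
open import Data.Product using (Σ; ∃; _×_; _,_; proj₁; proj₂)
open import Data.Product.Algebra using (×-assoc)
open import Data.Product.Function.NonDependent.Propositional using (_×-↔_)
open import Function using (_↔_; Inverse; mk↔ₛ′; _⇔_; mk⇔; Equivalence; _∘_; _$_)
open import Function.Construct.Composition using (_↔-∘_; _⇔-∘_)
open import Function.Construct.Symmetry using (↔-sym)
open import Function.Construct.Identity using (↔-id)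
open import Relation.Binary.PropositionalEquality
  using (_≡_; _≢_; refl; sym; trans; cong; cong₂; subst₂; module ≡-Reasoning)
open import Relation.Nullary using (does)
open import Relation.Nullary.Decidable using (dec-true; dec-false; does-⇔)

open Inverse using (to; from; strictlyInverseˡ; strictlyInverseʳ)
open ≡-Reasoning

_≋_ : {A : Set} → A ↔ A → A ↔ A → Set
π ≋ σ = ∀ x → to π x ≡ to σ x

from-cong : {A : Set} (π σ : A ↔ A) → π ≋ σ → ↔-sym π ≋ ↔-sym σ
from-cong π σ π≋σ x = begin
  from π x                    ≡⟨ strictlyInverseʳ σ _ ⟨
  from σ (to σ (from π x))    ≡⟨ cong (from σ) (π≋σ _) ⟨
  from σ (to π (from π x))    ≡⟨ cong (from σ) (strictlyInverseˡ π x) ⟩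
  from σ x                    ∎

inverse-maps : ∀ {n} (π : Permutation′ n) {x y} → π ⟨$⟩ʳ x ≡ y → π ⟨$⟩ˡ y ≡ x
inverse-maps π πx≡y = trans (cong (π ⟨$⟩ˡ_) (sym πx≡y)) (inverseˡ π)

-- A faithful representation of Sym(Fin d) by bijections of A: a well-defined,
-- injective homomorphism (composition ∘ₚ applies its left argument first).
record IsFaithfulRep {d : ℕ} {A : Set} (α : Permutation′ d → A ↔ A) : Set where
  field
    rep-cong      : ∀ g h → g ≈ h → α g ≋ α h
    rep-hom       : ∀ g h → α (g ∘ₚ h) ≋ (α h ↔-∘ α g)
    rep-injective : ∀ g h → α g ≋ α h → g ≈ h

module _ {d : ℕ} {A : Set} {α : Permutation′ d → A ↔ A} (rep : IsFaithfulRep α) where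
  open IsFaithfulRep rep

  rep-id : α id ≋ ↔-id A
  rep-id x = sym (begin
    x                              ≡⟨ strictlyInverseʳ e x ⟨
    from e (to e x)                ≡⟨ cong (from e) idempotent ⟩
    from e (to e (to e x))         ≡⟨ strictlyInverseʳ e _ ⟩
    to e x                         ∎)
    where
    e : A ↔ A
    e = α id
    idempotent : to e x ≡ to e (to e x)
    idempotent = trans (sym (rep-cong (id ∘ₚ id) id (λ _ → refl) x)) (rep-hom id id x)

  rep-flip : ∀ g → α (flip g) ≋ ↔-sym (α g)
  rep-flip g y = begin
    to (α (flip g)) y                     ≡⟨ cong (to (α (flip g))) (strictlyInverseˡ (α g) y) ⟨
    to (α (flip g)) (to (α g) z)          ≡⟨ rep-hom g (flip g) z ⟨
    to (α (g ∘ₚ flip g)) z                ≡⟨ rep-cong (g ∘ₚ flip g) id (λ _ → inverseˡ g) z ⟩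
    to (α id) z                           ≡⟨ rep-id z ⟩
    z                                     ∎
    where
    z : A
    z = from (α g) y

restrict-faithful : ∀ {d m} {α : Permutation′ d → Permutation′ m}
  → IsFaithfulRep α → (H : PermSet d) → IsFaithfulAction H (α ∘ proj₁)
restrict-faithful rep H = record
  { wellDef = λ g h g≈h → rep-cong (proj₁ g) (proj₁ h) g≈h
  ; hom     = λ g h gh gh≈ x → trans (rep-cong (proj₁ gh) (proj₁ g ∘ₚ proj₁ h) gh≈ x) (rep-hom (proj₁ g) (proj₁ h) x)
  ; inj     = λ g h ρg≈ρh → rep-injective (proj₁ g) (proj₁ h) ρg≈ρh
  }
  where open IsFaithfulRep rep

module Conjugation {A B : Set} (c : A ↔ B) where

  conj : B ↔ B → A ↔ A
  conj π = ↔-sym c ↔-∘ (π ↔-∘ c)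

  conj-cong : ∀ π σ → π ≋ σ → conj π ≋ conj σ
  conj-cong π σ π≋σ x = cong (from c) (π≋σ (to c x))

  conj-∘ : ∀ π σ → conj (σ ↔-∘ π) ≋ (conj σ ↔-∘ conj π)
  conj-∘ π σ x = cong (from c ∘ to σ) (sym (strictlyInverseˡ c _))

  conj-injective : ∀ π σ → conj π ≋ conj σ → π ≋ σ
  conj-injective π σ e y = begin
    to π y                           ≡⟨ cong (to π) (strictlyInverseˡ c y) ⟨
    to π (to c (from c y))           ≡⟨ strictlyInverseˡ c _ ⟨
    to c (to (conj π) (from c y))    ≡⟨ cong (to c) (e (from c y)) ⟩
    to c (to (conj σ) (from c y))    ≡⟨ strictlyInverseˡ c _ ⟩
    to σ (to c (from c y))           ≡⟨ cong (to σ) (strictlyInverseˡ c y) ⟩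
    to σ y                           ∎

  conj-fixes : ∀ π b → (to (conj π) (from c b) ≡ from c b) ⇔ (to π b ≡ b)
  conj-fixes π b = mk⇔ fixed→ fixed←
    where
    πb≡ : to π (to c (from c b)) ≡ to π b
    πb≡ = cong (to π) (strictlyInverseˡ c b)
    fixed→ : to (conj π) (from c b) ≡ from c b → to π b ≡ b
    fixed→ e = begin
      to π b                               ≡⟨ πb≡ ⟨
      to π (to c (from c b))               ≡⟨ strictlyInverseˡ c _ ⟨
      to c (to (conj π) (from c b))        ≡⟨ cong (to c) e ⟩
      to c (from c b)                      ≡⟨ strictlyInverseˡ c b ⟩
      b                                    ∎
    fixed← : to π b ≡ b → to (conj π) (from c b) ≡ from c b
    fixed← e = cong (from c) (trans πb≡ e)

  conj-commute : ∀ π σ → (σ ↔-∘ π) ≋ (π ↔-∘ σ) → (conj σ ↔-∘ conj π) ≋ (conj π ↔-∘ conj σ)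
  conj-commute π σ e x =
    trans (sym (conj-∘ π σ x)) (trans (conj-cong (σ ↔-∘ π) (π ↔-∘ σ) e x) (conj-∘ σ π x))

  conj-faithful : ∀ {d} {α : Permutation′ d → B ↔ B} → IsFaithfulRep α → IsFaithfulRep (conj ∘ α)
  conj-faithful {α = α} rep = record
    { rep-cong      = λ g h g≈h → conj-cong (α g) (α h) (rep-cong g h g≈h)
    ; rep-hom       = λ g h x → trans (conj-cong (α (g ∘ₚ h)) (α h ↔-∘ α g) (rep-hom g h) x) (conj-∘ (α g) (α h) x)
    ; rep-injective = λ g h e → rep-injective g h (conj-injective (α g) (α h) e)
    }
    where open IsFaithfulRep rep

stabiliser-subgroup : ∀ {n} {P : PermSet n} → IsSubgroup P → ∀ ω → IsSubgroup (Stab P ω)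
stabiliser-subgroup Ps ω = record
  { resp  = λ π≈σ (πP , πω) → resp π≈σ πP , trans (sym (π≈σ ω)) πω
  ; hasId = hasId , refl
  ; comp  = λ {π} {σ} (πP , πω) (σP , σω) → comp πP σP , trans (cong (σ ⟨$⟩ʳ_) πω) σω
  ; inv   = λ {π} (πP , πω) → inv πP , inverse-maps π πω
  }
  where open IsSubgroup Ps

image-subgroup : ∀ {d m} {H : PermSet d} {α : Permutation′ d → Permutation′ m}
  → IsSubgroup H → IsFaithfulRep α → IsSubgroup (Image H (α ∘ proj₁) H)
image-subgroup {α = α} Hs rep = record
  { resp  = λ π≈σ (g , gH , π≈) → g , gH , λ x → trans (sym (π≈σ x)) (π≈ x)
  ; hasId = (id , hasId) , hasId , λ x → sym (rep-id rep x)
  ; comp  = λ {π} {σ} ((g , gH) , _ , π≈) ((h , hH) , _ , σ≈) →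
      (g ∘ₚ h , comp gH hH) , comp gH hH ,
      λ x → trans (cong (σ ⟨$⟩ʳ_) (π≈ x)) (trans (σ≈ _) (sym (rep-hom g h x)))
  ; inv   = λ {π} ((g , gH) , _ , π≈) →
      (flip g , inv gH) , inv gH , λ x → trans (from-cong π (α g) π≈ x) (sym (rep-flip rep g x))
  }
  where
  open IsSubgroup Hs
  open IsFaithfulRep rep

generated-subgroup : ∀ {n} {A B : PermSet n} → IsSubgroup (Gen A B)
generated-subgroup = record { resp = gresp ; hasId = gid ; comp = gcmp ; inv = ginv }

stabiliser-image : ∀ {d m} {H : PermSet d} (ρ : Permutation′ d → Permutation′ m) {ω δ₀}
  → (∀ g → (ρ g ⟨$⟩ʳ ω ≡ ω) ⇔ (g ⟨$⟩ʳ δ₀ ≡ δ₀))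
  → Stab (Image H (ρ ∘ proj₁) H) ω ≐ Image H (ρ ∘ proj₁) (Stab H δ₀)
stabiliser-image ρ {ω} fixes π =
    (λ ((g , gH , π≈) , πω) →
       g , (gH , Equivalence.to (fixes (proj₁ g)) (trans (sym (π≈ ω)) πω)) , π≈)
  , (λ (g , (gH , gδ₀) , π≈) →
       (g , gH , π≈) , trans (π≈ ω) (Equivalence.from (fixes (proj₁ g)) gδ₀))

Commute : ∀ {n} → PermSet n → PermSet n → Set
Commute A B = ∀ {a b} → A a → B b → (a ∘ₚ b) ≈ (b ∘ₚ a)

commute-sym : ∀ {n} {A B : PermSet n} → Commute A B → Commute B A
commute-sym comm b∈B a∈A x = sym (comm a∈A b∈B x)

commute-resp : ∀ {n} {a a′ b b′ : Permutation′ n} → a ≈ a′ → b ≈ b′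
  → (a′ ∘ₚ b′) ≈ (b′ ∘ₚ a′) → (a ∘ₚ b) ≈ (b ∘ₚ a)
commute-resp {a = a} {a′} {b} {b′} a≈ b≈ comm x = begin
  b ⟨$⟩ʳ (a ⟨$⟩ʳ x)      ≡⟨ cong (b ⟨$⟩ʳ_) (a≈ x) ⟩
  b ⟨$⟩ʳ (a′ ⟨$⟩ʳ x)     ≡⟨ b≈ _ ⟩
  b′ ⟨$⟩ʳ (a′ ⟨$⟩ʳ x)    ≡⟨ comm x ⟩
  a′ ⟨$⟩ʳ (b′ ⟨$⟩ʳ x)    ≡⟨ cong (a′ ⟨$⟩ʳ_) (b≈ x) ⟨
  a′ ⟨$⟩ʳ (b ⟨$⟩ʳ x)     ≡⟨ a≈ _ ⟨
  a ⟨$⟩ʳ (b ⟨$⟩ʳ x)      ∎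

Gen-swap : ∀ {n} {A B : PermSet n} {π} → Gen A B π → Gen B A π
Gen-swap (inA p)      = inB p
Gen-swap (inB p)      = inA p
Gen-swap gid          = gid
Gen-swap (gcmp p q)   = gcmp (Gen-swap p) (Gen-swap q)
Gen-swap (ginv p)     = ginv (Gen-swap p)
Gen-swap (gresp e p)  = gresp e (Gen-swap p)

module _ {n} {A B : PermSet n} (As : IsSubgroup A) (Bs : IsSubgroup B) (comm : Commute A B) where
  private
    module A = IsSubgroup As
    module B = IsSubgroup Bs

  decompose : ∀ {π} → Gen A B π → ∃ λ a → ∃ λ b → A a × B b × (π ≈ (a ∘ₚ b))
  decompose {π} (inA π∈A) = π , id , π∈A , B.hasId , λ _ → refl
  decompose {π} (inB π∈B) = id , π , A.hasId , π∈B , λ _ → refl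
  decompose gid = id , id , A.hasId , B.hasId , λ _ → refl
  decompose (gcmp {π} {σ} p q) with decompose p | decompose q
  ... | a , b , a∈A , b∈B , π≈ | a′ , b′ , a′∈A , b′∈B , σ≈ =
    a ∘ₚ a′ , b ∘ₚ b′ , A.comp a∈A a′∈A , B.comp b∈B b′∈B , λ x → begin
      σ ⟨$⟩ʳ (π ⟨$⟩ʳ x)                          ≡⟨ cong (σ ⟨$⟩ʳ_) (π≈ x) ⟩
      σ ⟨$⟩ʳ (b ⟨$⟩ʳ (a ⟨$⟩ʳ x))                 ≡⟨ σ≈ _ ⟩
      b′ ⟨$⟩ʳ (a′ ⟨$⟩ʳ (b ⟨$⟩ʳ (a ⟨$⟩ʳ x)))      ≡⟨ cong (b′ ⟨$⟩ʳ_) (comm a′∈A b∈B _) ⟨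
      b′ ⟨$⟩ʳ (b ⟨$⟩ʳ (a′ ⟨$⟩ʳ (a ⟨$⟩ʳ x)))      ∎
  decompose (ginv {π} p) with decompose p
  ... | a , b , a∈A , b∈B , π≈ =
    flip a , flip b , A.inv a∈A , B.inv b∈B ,
    λ x → trans (from-cong π (a ∘ₚ b) π≈ x) (sym (comm (A.inv a∈A) (B.inv b∈B) x))
  decompose (gresp π≈σ p) with decompose p
  ... | a , b , a∈A , b∈B , π≈ = a , b , a∈A , b∈B , λ x → trans (sym (π≈σ x)) (π≈ x)

  -- Hence A is normal in ⟨A, B⟩: conjugating by a b is conjugating by a.
  left-normal : IsNormalIn A (Gen A B)
  left-normal {a} {g} a∈A g∈G with decompose g∈G
  ... | a′ , b′ , a′∈A , b′∈B , g≈ = A.resp conj≈ c∈A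
    where
    c : Permutation′ n
    c = flip a′ ∘ₚ (a ∘ₚ a′)
    c∈A : A c
    c∈A = A.comp (A.inv a′∈A) (A.comp a∈A a′∈A)
    conj≈ : c ≈ (flip g ∘ₚ (a ∘ₚ g))
    conj≈ x = sym (begin
      g ⟨$⟩ʳ (a ⟨$⟩ʳ (g ⟨$⟩ˡ x))                    ≡⟨ cong (λ z → g ⟨$⟩ʳ (a ⟨$⟩ʳ z)) (from-cong g (a′ ∘ₚ b′) g≈ x) ⟩
      g ⟨$⟩ʳ (a ⟨$⟩ʳ (a′ ⟨$⟩ˡ (b′ ⟨$⟩ˡ x)))        ≡⟨ g≈ _ ⟩
      b′ ⟨$⟩ʳ (c ⟨$⟩ʳ (b′ ⟨$⟩ˡ x))                  ≡⟨ comm c∈A b′∈B _ ⟩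
      c ⟨$⟩ʳ (b′ ⟨$⟩ʳ (b′ ⟨$⟩ˡ x))                  ≡⟨ cong (c ⟨$⟩ʳ_) (inverseʳ b′) ⟩
      c ⟨$⟩ʳ x                                       ∎)

internal-direct-product : ∀ {n} {A B : PermSet n} → IsSubgroup A → IsSubgroup B
  → Commute A B → (∀ π → A π → B π → π ≈ id) → IsInternalDirectProduct A B
internal-direct-product {A = A} {B} As Bs comm trivial =
    left-normal As Bs comm
  , (λ b∈B g∈G → left-normal Bs As (commute-sym {A = A} {B} comm) b∈B (Gen-swap g∈G))
  , trivial
  , (λ π → decompose As Bs comm)

Reach : ∀ {n} → PermSet n → Fin n → Fin n → Set
Reach G x y = ∃ λ π → G π × (π ⟨$⟩ʳ x ≡ y)

module _ {n} {G : PermSet n} (Gs : IsSubgroup G) where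
  open IsSubgroup Gs

  reach-trans : ∀ {x y z} → Reach G x y → Reach G y z → Reach G x z
  reach-trans (π , π∈G , πx≡y) (σ , σ∈G , σy≡z) =
    π ∘ₚ σ , comp π∈G σ∈G , trans (cong (σ ⟨$⟩ʳ_) πx≡y) σy≡z

  reach-sym : ∀ {x y} → Reach G x y → Reach G y x
  reach-sym (π , π∈G , πx≡y) = flip π , inv π∈G , inverse-maps π πx≡y

prev : ∀ {n} → Fin (suc n) → Fin (suc n)
prev {n} zero = fromℕ n
prev (suc i)  = inject₁ i

-- suc, except that the wrapped-around value zero stays zero
wrap-suc : ∀ {n} → Fin (suc n) → Fin (suc (suc n))
wrap-suc zero    = zero
wrap-suc (suc j) = suc (suc j)

-- i ↦ i + 1 (mod n + 1)
next : ∀ {n} → Fin (suc n) → Fin (suc n)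
next {zero}  zero    = zero
next {suc n} zero    = suc zero
next {suc n} (suc i) = wrap-suc (next i)

next-fromℕ : ∀ n → next (fromℕ n) ≡ zero
next-fromℕ zero    = refl
next-fromℕ (suc n) = cong wrap-suc (next-fromℕ n)

next-inject₁ : ∀ {n} (i : Fin n) → next (inject₁ i) ≡ suc i
next-inject₁ {suc n} zero    = refl
next-inject₁ {suc n} (suc i) = cong wrap-suc (next-inject₁ i)

next-prev : ∀ {n} (i : Fin (suc n)) → next (prev i) ≡ i
next-prev {n} zero = next-fromℕ n
next-prev (suc i)  = next-inject₁ i

prev-next : ∀ {n} (i : Fin (suc n)) → prev (next i) ≡ i
prev-next {zero}  zero    = refl
prev-next {suc n} zero    = refl
prev-next {suc n} (suc i) with next i | prev-next i
... | zero  | prev≡i = cong suc prev≡i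
... | suc j | prev≡i = cong suc prev≡i

rotation : ∀ {n} → Permutation′ (suc n)
rotation = permutation prev next prev-next next-prev

shift : ∀ {n} → Bool → Permutation′ (suc n)
shift true  = rotation
shift false = id

test-invariant : ∀ {n} (π : Permutation′ n) {p} → π ⟨$⟩ʳ p ≡ p
  → ∀ x → does (π ⟨$⟩ʳ x ≟ p) ≡ does (x ≟ p)
test-invariant π {p} πp≡p x = does-⇔ (mk⇔ moved-to-p fixed) (π ⟨$⟩ʳ x ≟ p) (x ≟ p)
  where
  moved-to-p : π ⟨$⟩ʳ x ≡ p → x ≡ p
  moved-to-p πx≡p = trans (sym (inverseˡ π)) (trans (cong (π ⟨$⟩ˡ_) πx≡p) (inverse-maps π πp≡p))
  fixed : x ≡ p → π ⟨$⟩ʳ x ≡ p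
  fixed refl = πp≡p

module Construction (ℓ′ d k : ℕ) (δ₀ : Fin d) (λ₀ : Fin k) where

  -- the fibre size ℓ = suc ℓ′ is positive, so fibres have a point 0 and a rotation
  L : ℕ
  L = suc ℓ′

  N : ℕ
  N = L * d * k

  Ω : Set
  Ω = Fin L × Fin d × Fin k

  code : Fin N ↔ Ω
  code = ×-assoc _ _ _ _ ↔-∘ ((*↔× ×-↔ ↔-id _) ↔-∘ *↔×)

  ω₀ : Ω
  ω₀ = zero , δ₀ , λ₀

  marked : Fin d → Fin k → Bool
  marked δ μ = does (δ ≟ δ₀) ∧ does (μ ≟ λ₀)

  marked₀ : marked δ₀ λ₀ ≡ true
  marked₀ = cong₂ _∧_ (dec-true (δ₀ ≟ δ₀) refl) (dec-true (λ₀ ≟ λ₀) refl)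

  unmarked-δ : ∀ {δ} μ → δ ≢ δ₀ → marked δ μ ≡ false
  unmarked-δ {δ} μ δ≢δ₀ = cong (_∧ does (μ ≟ λ₀)) (dec-false (δ ≟ δ₀) δ≢δ₀)

  unmarked-μ : ∀ δ {μ} → μ ≢ λ₀ → marked δ μ ≡ false
  unmarked-μ δ {μ} μ≢λ₀ =
    trans (cong (does (δ ≟ δ₀) ∧_) (dec-false (μ ≟ λ₀) μ≢λ₀)) (∧-zeroʳ _)

  twist : Ω ↔ Ω
  twist = mk↔ₛ′
    (λ (i , δ , μ) → shift (marked δ μ) ⟨$⟩ʳ i , δ , μ)
    (λ (i , δ , μ) → shift (marked δ μ) ⟨$⟩ˡ i , δ , μ)
    (λ (i , δ , μ) → cong (_, δ , μ) (inverseʳ (shift (marked δ μ))))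
    (λ (i , δ , μ) → cong (_, δ , μ) (inverseˡ (shift (marked δ μ))))

  onΔ : Permutation′ d → Ω ↔ Ω
  onΔ η = mk↔ₛ′
    (λ (i , δ , μ) → i , η ⟨$⟩ʳ δ , μ)
    (λ (i , δ , μ) → i , η ⟨$⟩ˡ δ , μ)
    (λ (i , δ , μ) → cong (λ z → i , z , μ) (inverseʳ η))
    (λ (i , δ , μ) → cong (λ z → i , z , μ) (inverseˡ η))

  onΛ : Permutation′ k → Ω ↔ Ω
  onΛ κ = mk↔ₛ′
    (λ (i , δ , μ) → i , δ , κ ⟨$⟩ʳ μ)
    (λ (i , δ , μ) → i , δ , κ ⟨$⟩ˡ μ)
    (λ (i , δ , μ) → cong (λ z → i , δ , z) (inverseʳ κ))
    (λ (i , δ , μ) → cong (λ z → i , δ , z) (inverseˡ κ))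

  onΛ-fixes : ∀ κ i δ μ → (to (onΛ κ) (i , δ , μ) ≡ (i , δ , μ)) ⇔ (κ ⟨$⟩ʳ μ ≡ μ)
  onΛ-fixes κ i δ μ = mk⇔ (cong (proj₂ ∘ proj₂)) (cong (λ z → i , δ , z))

  -- the coordinate actions are faithful homomorphisms (the other coordinates are inhabited)
  onΔ-faithful : IsFaithfulRep onΔ
  onΔ-faithful = record
    { rep-cong      = λ g h g≈h (i , δ , μ) → cong (λ z → i , z , μ) (g≈h δ)
    ; rep-hom       = λ g h p → refl
    ; rep-injective = λ g h e δ → cong (proj₁ ∘ proj₂) (e (zero , δ , λ₀))
    }

  onΛ-faithful : IsFaithfulRep onΛ
  onΛ-faithful = record
    { rep-cong      = λ g h g≈h (i , δ , μ) → cong (λ z → i , δ , z) (g≈h μ)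
    ; rep-hom       = λ g h p → refl
    ; rep-injective = λ g h e μ → cong (proj₂ ∘ proj₂) (e (zero , δ₀ , μ))
    }

  module Twist = Conjugation twist
  module Code  = Conjugation code

  actΔ : Permutation′ d → Ω ↔ Ω
  actΔ η = Twist.conj (onΔ η)

  -- the fibre coordinate of actΔ η (i, δ, μ)
  drift : Permutation′ d → Fin d → Fin k → Fin L → Fin L
  drift η δ μ i = shift (marked (η ⟨$⟩ʳ δ) μ) ⟨$⟩ˡ (shift (marked δ μ) ⟨$⟩ʳ i)

  drift-unmarked : ∀ η δ μ i → marked (η ⟨$⟩ʳ δ) μ ≡ marked δ μ → drift η δ μ i ≡ i
  drift-unmarked η δ μ i same =
    trans (cong (λ b → shift b ⟨$⟩ˡ (shift (marked δ μ) ⟨$⟩ʳ i)) same) (inverseˡ (shift (marked δ μ)))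

  drift-value : ∀ η δ μ i {b c} → marked (η ⟨$⟩ʳ δ) μ ≡ b → marked δ μ ≡ c
    → drift η δ μ i ≡ shift b ⟨$⟩ˡ (shift c ⟨$⟩ʳ i)
  drift-value η δ μ i = cong₂ (λ b c → shift b ⟨$⟩ˡ (shift c ⟨$⟩ʳ i))

  actΔ-fixes : ∀ η i δ μ → (to (actΔ η) (i , δ , μ) ≡ (i , δ , μ)) ⇔ (η ⟨$⟩ʳ δ ≡ δ)
  actΔ-fixes η i δ μ = mk⇔ (cong (proj₁ ∘ proj₂)) fixed
    where
    fixed : η ⟨$⟩ʳ δ ≡ δ → to (actΔ η) (i , δ , μ) ≡ (i , δ , μ)
    fixed ηδ≡δ = cong₂ (λ j δ′ → j , δ′ , μ)
      (drift-unmarked η δ μ i (cong (λ δ′ → marked δ′ μ) ηδ≡δ)) ηδ≡δ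

  commute-by-drift : ∀ η κ → (∀ δ μ i → drift η δ (κ ⟨$⟩ʳ μ) i ≡ drift η δ μ i)
    → (onΛ κ ↔-∘ actΔ η) ≋ (actΔ η ↔-∘ onΛ κ)
  commute-by-drift η κ same (i , δ , μ) = cong (λ j → j , η ⟨$⟩ʳ δ , κ ⟨$⟩ʳ μ) (sym (same δ μ i))

  -- If κ fixes λ₀ it preserves the marking.
  drift-κ-fixes : ∀ η κ → κ ⟨$⟩ʳ λ₀ ≡ λ₀ → ∀ δ μ i → drift η δ (κ ⟨$⟩ʳ μ) i ≡ drift η δ μ i
  drift-κ-fixes η κ κλ₀ δ μ i = drift-value η δ (κ ⟨$⟩ʳ μ) i (preserves (η ⟨$⟩ʳ δ)) (preserves δ)
    where
    preserves : ∀ δ′ → marked δ′ (κ ⟨$⟩ʳ μ) ≡ marked δ′ μ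
    preserves δ′ = cong (does (δ′ ≟ δ₀) ∧_) (test-invariant κ κλ₀ μ)

  -- If η fixes δ₀ it has no drift at all.
  drift-η-fixes : ∀ η κ → η ⟨$⟩ʳ δ₀ ≡ δ₀ → ∀ δ μ i → drift η δ (κ ⟨$⟩ʳ μ) i ≡ drift η δ μ i
  drift-η-fixes η κ ηδ₀ δ μ i =
    trans (no-drift (κ ⟨$⟩ʳ μ)) (sym (no-drift μ))
    where
    no-drift : ∀ μ′ → drift η δ μ′ i ≡ i
    no-drift μ′ = drift-unmarked η δ μ′ i (cong (_∧ does (μ′ ≟ λ₀)) (test-invariant η ηδ₀ δ))

  ρH : Permutation′ d → Permutation′ N
  ρH η = Code.conj (actΔ η)

  ρK : Permutation′ k → Permutation′ N
  ρK κ = Code.conj (onΛ κ)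

  ω : Fin N
  ω = from code ω₀

  ρH-faithful : IsFaithfulRep ρH
  ρH-faithful = Code.conj-faithful (Twist.conj-faithful onΔ-faithful)

  ρK-faithful : IsFaithfulRep ρK
  ρK-faithful = Code.conj-faithful onΛ-faithful

  ρH-fixes : ∀ η → (ρH η ⟨$⟩ʳ ω ≡ ω) ⇔ (η ⟨$⟩ʳ δ₀ ≡ δ₀)
  ρH-fixes η = actΔ-fixes η zero δ₀ λ₀ ⇔-∘ Code.conj-fixes (actΔ η) ω₀

  ρK-fixes : ∀ κ → (ρK κ ⟨$⟩ʳ ω ≡ ω) ⇔ (κ ⟨$⟩ʳ λ₀ ≡ λ₀)
  ρK-fixes κ = onΛ-fixes κ zero δ₀ λ₀ ⇔-∘ Code.conj-fixes (onΛ κ) ω₀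

  ρ-commute : ∀ η κ → (∀ δ μ i → drift η δ (κ ⟨$⟩ʳ μ) i ≡ drift η δ μ i)
    → (ρH η ∘ₚ ρK κ) ≈ (ρK κ ∘ₚ ρH η)
  ρ-commute η κ same = Code.conj-commute (actΔ η) (onΛ κ) (commute-by-drift η κ same)

  actΔ-meets-onΛ : ∀ η κ → actΔ η ≋ onΛ κ → η ≈ id
  actΔ-meets-onΛ η κ e δ = cong (proj₁ ∘ proj₂) (e (zero , δ , λ₀))

  ρ-trivial : ∀ η κ → ρH η ≈ ρK κ → ρH η ≈ id
  ρ-trivial η κ e x = trans (rep-cong η id η≈id x) (rep-id ρH-faithful x)
    where
    open IsFaithfulRep ρH-faithful
    η≈id : η ≈ id
    η≈id = actΔ-meets-onΛ η κ (Code.conj-injective (actΔ η) (onΛ κ) e)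

  module Subgroups {H : PermSet d} {K : PermSet k} (Hs : IsSubgroup H) (Ks : IsSubgroup K) where

    imH : PermSet N
    imH = Image H (ρH ∘ proj₁) H

    imK : PermSet N
    imK = Image K (ρK ∘ proj₁) K

    imH-subgroup : IsSubgroup imH
    imH-subgroup = image-subgroup Hs ρH-faithful

    imK-subgroup : IsSubgroup imK
    imK-subgroup = image-subgroup Ks ρK-faithful

    trivial-intersection : ∀ π → imH π → imK π → π ≈ id
    trivial-intersection π ((η , _) , _ , π≈) ((κ , _) , _ , π≈′) x =
      trans (π≈ x) (ρ-trivial η κ (λ y → trans (sym (π≈ y)) (π≈′ y)) x)

    -- ρH(H) commutes with the stabiliser ρK(K_{λ₀}).  (The implicit arguments of
    -- commuting are passed on explicitly: Agda cannot recover them from membership.)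
    direct-product-H : IsInternalDirectProduct imH (Stab imK ω)
    direct-product-H =
      internal-direct-product imH-subgroup (stabiliser-subgroup imK-subgroup ω) (λ {a} {b} → commuting {a} {b})
        (λ π a∈ (b∈ , _) → trivial-intersection π a∈ b∈)
      where
      commuting : Commute imH (Stab imK ω)
      commuting {a} {b} ((η , _) , _ , a≈) (((κ , _) , _ , b≈) , bω≡ω) =
        commute-resp {a = a} {ρH η} {b} {ρK κ} a≈ b≈ (ρ-commute η κ (drift-κ-fixes η κ κλ₀≡λ₀))
        where
        κλ₀≡λ₀ : κ ⟨$⟩ʳ λ₀ ≡ λ₀
        κλ₀≡λ₀ = Equivalence.to (ρK-fixes κ) (trans (sym (b≈ ω)) bω≡ω)

    direct-product-K : IsInternalDirectProduct (Stab imH ω) imK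
    direct-product-K =
      internal-direct-product (stabiliser-subgroup imH-subgroup ω) imK-subgroup (λ {a} {b} → commuting {a} {b})
        (λ π (a∈ , _) b∈ → trivial-intersection π a∈ b∈)
      where
      commuting : Commute (Stab imH ω) imK
      commuting {a} {b} (((η , _) , _ , a≈) , aω≡ω) ((κ , _) , _ , b≈) =
        commute-resp {a = a} {ρH η} {b} {ρK κ} a≈ b≈ (ρ-commute η κ (drift-η-fixes η κ ηδ₀≡δ₀))
        where
        ηδ₀≡δ₀ : η ⟨$⟩ʳ δ₀ ≡ δ₀
        ηδ₀≡δ₀ = Equivalence.to (ρH-fixes η) (trans (sym (a≈ ω)) aω≡ω)

    module Orbits (Ht : IsTransitive H) (Kt : IsTransitive K)
                  {δ₁ λ₁} (δ₁≢δ₀ : δ₁ ≢ δ₀) (λ₁≢λ₀ : λ₁ ≢ λ₀) where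

      G : PermSet N
      G = Gen imH imK

      record _⇝_ (p q : Ω) : Set where
        constructor reach
        field reached : Reach G (from code p) (from code q)

      ⇝-trans : ∀ {p q r} → p ⇝ q → q ⇝ r → p ⇝ r
      ⇝-trans (reach p⇝q) (reach q⇝r) = reach (reach-trans generated-subgroup p⇝q q⇝r)

      ⇝-sym : ∀ {p q} → p ⇝ q → q ⇝ p
      ⇝-sym (reach p⇝q) = reach (reach-sym generated-subgroup p⇝q)

      ⇝-≡ : ∀ {p q q′} → p ⇝ q → q ≡ q′ → p ⇝ q′
      ⇝-≡ p⇝q refl = p⇝q

      h-move : ∀ {η} → H η → ∀ p → p ⇝ to (actΔ η) p
      h-move {η} η∈H p = reach $
        ρH η , inA ((η , η∈H) , η∈H , λ _ → refl) ,
        cong (from code ∘ to (actΔ η)) (strictlyInverseˡ code p)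

      k-move : ∀ {κ} → K κ → ∀ p → p ⇝ to (onΛ κ) p
      k-move {κ} κ∈K p = reach $
        ρK κ , inB ((κ , κ∈K) , κ∈K , λ _ → refl) ,
        cong (from code ∘ to (onΛ κ)) (strictlyInverseˡ code p)

      -- K moves μ to λ₀, then H moves δ to δ₀.
      to-marked-fibre : ∀ p → ∃ λ j → p ⇝ (j , δ₀ , λ₀)
      to-marked-fibre (i , δ , μ) with Kt μ λ₀ | Ht δ δ₀
      ... | κ , κ∈K , κμ≡λ₀ | η , η∈H , ηδ≡δ₀ =
        drift η δ λ₀ i ,
        ⇝-trans (⇝-≡ (k-move κ∈K (i , δ , μ)) (cong (λ z → i , δ , z) κμ≡λ₀))
                (⇝-≡ (h-move η∈H (i , δ , λ₀)) (cong (λ z → drift η δ λ₀ i , z , λ₀) ηδ≡δ₀))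

      -- With η δ₀ = δ₁ and κ λ₀ = λ₁, the commutator η κ η⁻¹ κ⁻¹ rotates the
      -- marked fibre: only its first step meets a marked cell.
      rotate-marked : ∀ i → (i , δ₀ , λ₀) ⇝ (prev i , δ₀ , λ₀)
      rotate-marked i with Ht δ₀ δ₁ | Kt λ₀ λ₁
      ... | η , η∈H , ηδ₀≡δ₁ | κ , κ∈K , κλ₀≡λ₁ =
        ⇝-trans (⇝-≡ (h-move η∈H _) step₁)
        (⇝-trans (⇝-≡ (k-move κ∈K _) step₂)
        (⇝-trans (⇝-≡ (h-move (IsSubgroup.inv Hs η∈H) _) step₃)
                 (⇝-≡ (k-move (IsSubgroup.inv Ks κ∈K) _) step₄)))
        where
        η⁻¹δ₁≡δ₀ : flip η ⟨$⟩ʳ δ₁ ≡ δ₀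
        η⁻¹δ₁≡δ₀ = inverse-maps η ηδ₀≡δ₁
        step₁ : to (actΔ η) (i , δ₀ , λ₀) ≡ (prev i , δ₁ , λ₀)
        step₁ = cong₂ (λ j δ′ → j , δ′ , λ₀)
          (drift-value η δ₀ λ₀ i
            (trans (cong (λ δ′ → marked δ′ λ₀) ηδ₀≡δ₁) (unmarked-δ λ₀ δ₁≢δ₀)) marked₀)
          ηδ₀≡δ₁
        step₂ : to (onΛ κ) (prev i , δ₁ , λ₀) ≡ (prev i , δ₁ , λ₁)
        step₂ = cong (λ z → prev i , δ₁ , z) κλ₀≡λ₁
        step₃ : to (actΔ (flip η)) (prev i , δ₁ , λ₁) ≡ (prev i , δ₀ , λ₁)
        step₃ = cong₂ (λ j δ′ → j , δ′ , λ₁)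
          (drift-value (flip η) δ₁ λ₁ (prev i)
            (unmarked-μ (flip η ⟨$⟩ʳ δ₁) λ₁≢λ₀) (unmarked-μ δ₁ λ₁≢λ₀))
          η⁻¹δ₁≡δ₀
        step₄ : to (onΛ (flip κ)) (prev i , δ₀ , λ₁) ≡ (prev i , δ₀ , λ₀)
        step₄ = cong (λ z → prev i , δ₀ , z) (inverse-maps κ κλ₀≡λ₁)

      marked-fibre : ∀ j → (zero , δ₀ , λ₀) ⇝ (j , δ₀ , λ₀)
      marked-fibre = >-weakInduction (λ j → (zero , δ₀ , λ₀) ⇝ (j , δ₀ , λ₀))
        (rotate-marked zero) (λ i reach-suc → ⇝-trans reach-suc (rotate-marked (suc i)))

      connected : ∀ p q → p ⇝ q
      connected p q with to-marked-fibre p | to-marked-fibre q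
      ... | j , p⇝j | j′ , q⇝j′ =
        ⇝-trans p⇝j (⇝-trans (⇝-sym (marked-fibre j)) (⇝-trans (marked-fibre j′) (⇝-sym q⇝j′)))

      transitive : IsTransitive G
      transitive x y = subst₂ (Reach G) (strictlyInverseʳ code x) (strictlyInverseʳ code y)
        (_⇝_.reached (connected (to code x) (to code y)))

lemma4p1 : (d k ℓ : ℕ) → (H : PermSet d) → (K : PermSet k) → IsSubgroup H → IsSubgroup K → IsTransitive H → IsTransitive K → (δ₀ : Fin d) → (λ₀ : Fin k) → 1 ≤ ℓ → d ≥ 2 → k ≥ 2
    → Σ (Elt H → Permutation′ (ℓ * d * k)) λ ρH → Σ (Elt K → Permutation′ (ℓ * d * k)) λ ρK → Σ (Fin (ℓ * d * k)) λ ω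
    → IsFaithfulAction H ρH × IsFaithfulAction K ρK
    × (Stab (Image H ρH H) ω ≐ Image H ρH (Stab H δ₀))
    × (Stab (Image K ρK K) ω ≐ Image K ρK (Stab K λ₀))
    × IsInternalDirectProduct (Image H ρH H) (Stab (Image K ρK K) ω)
    × IsInternalDirectProduct (Stab (Image H ρH H) ω) (Image K ρK K)
    × IsTransitive (Gen (Image H ρH H) (Image K ρK K))
lemma4p1 d@(suc (suc _)) k@(suc (suc _)) (suc ℓ′) H K Hs Ks Ht Kt δ₀ λ₀ (s≤s z≤n) (s≤s (s≤s z≤n)) (s≤s (s≤s z≤n)) =
    ρH ∘ proj₁ , ρK ∘ proj₁ , ω
  , restrict-faithful ρH-faithful H , restrict-faithful ρK-faithful K
  , stabiliser-image ρH ρH-fixes , stabiliser-image ρK ρK-fixes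
  , direct-product-H , direct-product-K
  , transitive
  where
  open Construction ℓ′ d k δ₀ λ₀
  open Subgroups Hs Ks
  -- d, k ≥ 2 provide second points δ₁ ≠ δ₀ and λ₁ ≠ λ₀
  open Orbits Ht Kt (punchInᵢ≢i δ₀ zero) (punchInᵢ≢i λ₀ zero)
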